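{- Let $P_q(t)=\sum_{n\geq1}\dfrac{[p_n]_q}{[n]_q}t^n\in\Lambda_K[[t]]$. Then \[ E(t)=\mathbf{e}_q\big[-P_q(-t)\big]_q . \]
   Context: Let $q$ be an indeterminate, $K$ a field containing $\mathbb{Q}(q)$, $\Lambda_K$ the algebra of symmetric functions in $x_1,x_2,\dots$ over $K$, $e_n$ the elementary symmetric functions ($e_0=1$), $E(t)=\sum_{n\ge0}e_nt^n$. $[n]_q=1+q+\cdots+q^{n-1}$ ($n\ge1$), $[0]_q=0$, $[n]_q!=[1]_q\cdots[n]_q$, $[0]_q!=1$. For a formal power series $F(t)$, $D_qF(t)=\dfrac{F(qt)-F(t)}{(q-1)t}$. The $q$-power sums $[p_n]_q\in\Lambda_K$ are defined by $\sum_{n\geq1}[p_n]_q(-t)^{n-1}=D_qE(t)/E(t)$. Gessel's $q$-composition: for $A$ a commutative algebra over a field containing $\mathbb{Q}(q)$ and $F\in A[[t]]$ with $F(0)=0$, set $F^{[0]}=1$ and, for $k\geq1$, let $F^{[k]}$ be the unique series with zero constant term such that $D_qF^{[k]}=[k]_qF^{[k-1]}D_qF$ (the coefficient of $t^n$ in $F^{[k]}$ vanishes for $n<k$). For $G(t)=\sum_{k\ge0}g_k t^k/[k]_q!\in A[[t]]$, define $G[F]_q=\sum_{k\geq0}g_k F^{[k]}/[k]_q!$. Finally $\mathbf{e}_q(t)=\sum_{n\geq0}t^n/[n]_q!$. -}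

module Defs where

open import Level using (Level; _⊔_) renaming (suc to lsuc)
open import Algebra.Bundles using (CommutativeRing)
open import Algebra.Morphism.Structures using (module RingMorphisms)
open import Data.Nat using (ℕ; zero; suc; _∸_)
open import Data.Integer using (ℤ; +_; -[1+_])
open import Data.List using (List; []; _∷_)
open import Data.List.Relation.Unary.All using (All)
open import Data.Product using (_×_)
open import Relation.Binary.PropositionalEquality using (_≡_)
open import Relation.Nullary using (¬_)

-- Fields (not in agda-stdlib): a commutative ring, 1 ≠ 0, with an
-- inverse operation that is a two-sided inverse on nonzero elements
-- (its value at 0 is irrelevant).

record Field (c ℓ : Level) : Set (lsuc (c ⊔ ℓ)) where
  field
    commutativeRing : CommutativeRing c ℓ
  open CommutativeRing commutativeRing public
  field
    _⁻¹        : Carrier → Carrier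
    1≉0        : ¬ (1# ≈ 0#)
    ⁻¹-inverse : ∀ x → ¬ (x ≈ 0#) → (x * (x ⁻¹)) ≈ 1#

-- "K contains Q(q)": the element q of K is transcendental over the prime
-- ring, i.e. no nonzero integer polynomial vanishes at q.  (This forces
-- characteristic 0, and then the subfield generated by q is Q(q).)

module _ {c ℓ : Level} (K : Field c ℓ) where
  open Field K

  natK : ℕ → Carrier
  natK zero    = 0#
  natK (suc n) = 1# + natK n

  intK : ℤ → Carrier
  intK (+ n)      = natK n
  intK -[1+ n ]   = - natK (suc n)

  evalℤ : List ℤ → Carrier → Carrier
  evalℤ []       x = 0#
  evalℤ (a ∷ as) x = intK a + x * evalℤ as x

  Transcendental : Carrier → Set ℓ
  Transcendental q = ∀ (as : List ℤ) → evalℤ as q ≈ 0# → All (_≡ + 0) as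

module RingOps {c ℓ : Level} (R : CommutativeRing c ℓ) where
  open CommutativeRing R

  pow : Carrier → ℕ → Carrier
  pow x zero    = 1#
  pow x (suc n) = x * pow x n

  sumBelow : (ℕ → Carrier) → ℕ → Carrier
  sumBelow f zero    = 0#
  sumBelow f (suc n) = sumBelow f n + f n

  sumUpTo : (ℕ → Carrier) → ℕ → Carrier
  sumUpTo f n = sumBelow f (suc n)

  prodFrom1 : (ℕ → Carrier) → ℕ → Carrier
  prodFrom1 f zero    = 1#
  prodFrom1 f (suc n) = prodFrom1 f n * f (suc n)

  qint : Carrier → ℕ → Carrier
  qint q n = sumBelow (pow q) n

  qfact : Carrier → ℕ → Carrier
  qfact q = prodFrom1 (qint q)

  sign : ℕ → Carrier
  sign n = pow (- 1#) n

IsAlgebraMap : {c ℓ c' ℓ' : Level} (K : Field c ℓ) (A : CommutativeRing c' ℓ') →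
               (Field.Carrier K → CommutativeRing.Carrier A) → Set (c ⊔ ℓ ⊔ ℓ')
IsAlgebraMap K A ι =
  RingMorphisms.IsRingHomomorphism (Field.rawRing K) (CommutativeRing.rawRing A) ι

module QCalculus {c ℓ c' ℓ' : Level} (K : Field c ℓ) (q : Field.Carrier K)
                 (A : CommutativeRing c' ℓ')
                 (ι : Field.Carrier K → CommutativeRing.Carrier A) where
  module K = Field K
  module KO = RingOps K.commutativeRing
  open CommutativeRing A
  open RingOps A

  Series : Set c'
  Series = ℕ → Carrier

  _≈ₛ_ : Series → Series → Set ℓ'
  F ≈ₛ G = ∀ n → F n ≈ G n

  oneₛ : Series
  oneₛ zero    = 1#
  oneₛ (suc n) = 0#

  _*ₛ_ : Series → Series → Series
  (F *ₛ G) n = sumUpTo (λ j → F j * G (n ∸ j)) n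

  negArg : Series → Series
  negArg F n = sign n * F n

  [_]q : ℕ → Carrier
  [ n ]q = ι (KO.qint q n)

  inv[_]q : ℕ → Carrier
  inv[ n ]q = ι ((KO.qint q n) K.⁻¹)

  inv[_]q! : ℕ → Carrier
  inv[ n ]q! = ι ((KO.qfact q n) K.⁻¹)

  -- D_q F(t) = (F(qt) - F(t)) / ((q-1) t); its t^n coefficient is
  -- (q^(n+1) - 1)/(q - 1) · F_(n+1) = [n+1]_q F_(n+1).
  Dq : Series → Series
  Dq F n = [ suc n ]q * F (suc n)

  -- p : ℕ → A are the q-power sums [p_n]_q (index n ≥ 1; p 0 unused)
  -- iff  D_q E(t) = E(t) · Σ_{n≥1} [p_n]_q (-t)^(n-1),
  -- i.e. Σ [p_n]_q (-t)^(n-1) = D_q E(t) / E(t)  (E(t) is invertible).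
  IsQPowerSums : Series → (ℕ → Carrier) → Set ℓ'
  IsQPowerSums E p = Dq E ≈ₛ (E *ₛ (λ m → sign m * p (suc m)))

  Pq : (ℕ → Carrier) → Series
  Pq p zero    = 0#
  Pq p (suc n) = p (suc n) * inv[ suc n ]q

  negNeg : Series → Series
  negNeg F n = - (negArg F n)

  -- Fk is the family of q-powers F^[k] of F (F(0) = 0):
  -- F^[0] = 1, and for k ≥ 1, F^[k] has zero constant term and
  -- D_q F^[k] = [k]_q F^[k-1] D_q F.  (These determine Fk uniquely.)
  IsQPowers : Series → (ℕ → Series) → Set ℓ'
  IsQPowers F Fk =
    (Fk 0 ≈ₛ oneₛ) ×
    ((∀ k → Fk (suc k) 0 ≈ 0#) ×
     (∀ k → Dq (Fk (suc k)) ≈ₛ (λ n → [ suc k ]q * (Fk k *ₛ Dq F) n)))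

  -- e_q[F]_q = Σ_{k≥0} F^[k] / [k]_q!; its t^n coefficient is the finite
  -- sum over k ≤ n, since F^[k] has no terms of degree < k.
  eqCompose : (ℕ → Series) → Series
  eqCompose Fk n = sumUpTo (λ k → inv[ k ]q! * Fk k n) n

-- With F = -P_q(-t), one has D_q F = Σ_{n≥1} [p_n]_q (-t)^(n-1), so the defining relation of the
-- q-power sums reads D_q E = E · D_q F.  The q-power rule D_q F^[k] = [k]_q F^[k-1] D_q F gives
-- the same q-differential equation D_q G = G · D_q F for G = e_q[F]_q, and G(0) = 1 = E(0).
-- Since every [n]_q is invertible (q is transcendental), the t^(n+1) coefficient of a solution is
-- determined by its coefficients of degree ≤ n, so E = G.
module Submission where

open import Defs
open import Level using (Level)
open import Algebra.Bundles using (CommutativeRing)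
open import Algebra.Morphism.Structures using (module RingMorphisms)
import Algebra.Properties.CommutativeSemigroup as CommutativeSemigroupProperties
import Algebra.Properties.Ring as RingProperties
open import Data.Nat using (ℕ; zero; suc; _∸_; _≤_; _<_; _≤′_; ≤′-reflexive; ≤′-step; s≤s; s≤s⁻¹)
open import Data.Nat.Properties using (m<n⇒m<1+n; n<1+n; ≤-<-trans; ≤⇒≤′; ≤′⇒≤)
open import Data.Nat.Induction using (<-rec)
open import Data.Integer using (+_)
open import Data.List using (replicate)
open import Data.List.Relation.Unary.All using (_∷_)
open import Data.Product using (proj₁; proj₂)
import Relation.Binary.PropositionalEquality as ≡
open import Relation.Nullary using (¬_)

module SumProperties {c ℓ : Level} (R : CommutativeRing c ℓ) where
  open CommutativeRing R
  open RingOps R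
  open CommutativeSemigroupProperties +-commutativeSemigroup using (interchange)

  sumBelow-cong : ∀ {f g : ℕ → Carrier} n → (∀ {i} → i < n → f i ≈ g i) →
                  sumBelow f n ≈ sumBelow g n
  sumBelow-cong zero    f≈g = refl
  sumBelow-cong (suc n) f≈g = +-cong (sumBelow-cong n (λ i<n → f≈g (m<n⇒m<1+n i<n))) (f≈g (n<1+n n))

  sumBelow-zero : ∀ {f : ℕ → Carrier} n → (∀ {i} → i < n → f i ≈ 0#) → sumBelow f n ≈ 0#
  sumBelow-zero zero    f≈0 = refl
  sumBelow-zero (suc n) f≈0 =
    trans (+-cong (sumBelow-zero n (λ i<n → f≈0 (m<n⇒m<1+n i<n))) (f≈0 (n<1+n n))) (+-identityʳ 0#)

  sumBelow-+ : ∀ (f g : ℕ → Carrier) n →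
               sumBelow (λ i → f i + g i) n ≈ sumBelow f n + sumBelow g n
  sumBelow-+ f g zero    = sym (+-identityʳ 0#)
  sumBelow-+ f g (suc n) = trans (+-congʳ (sumBelow-+ f g n)) (interchange _ _ _ _)

  *-distribˡ-sumBelow : ∀ a (f : ℕ → Carrier) n → a * sumBelow f n ≈ sumBelow (λ i → a * f i) n
  *-distribˡ-sumBelow a f zero    = zeroʳ a
  *-distribˡ-sumBelow a f (suc n) = trans (distribˡ a _ _) (+-congʳ (*-distribˡ-sumBelow a f n))

  *-distribʳ-sumBelow : ∀ a (f : ℕ → Carrier) n → sumBelow f n * a ≈ sumBelow (λ i → f i * a) n
  *-distribʳ-sumBelow a f zero    = zeroˡ a
  *-distribʳ-sumBelow a f (suc n) = trans (distribʳ a _ _) (+-congʳ (*-distribʳ-sumBelow a f n))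

  sumBelow-suc : ∀ (f : ℕ → Carrier) n → sumBelow f (suc n) ≈ f 0 + sumBelow (λ i → f (suc i)) n
  sumBelow-suc f zero    = trans (+-identityˡ _) (sym (+-identityʳ _))
  sumBelow-suc f (suc n) = trans (+-congʳ (sumBelow-suc f n)) (+-assoc _ _ _)

  sumBelow-swap : ∀ (g : ℕ → ℕ → Carrier) m n →
                  sumBelow (λ i → sumBelow (g i) n) m ≈ sumBelow (λ j → sumBelow (λ i → g i j) m) n
  sumBelow-swap g zero    n = sym (sumBelow-zero n (λ _ → refl))
  sumBelow-swap g (suc m) n = trans (+-congʳ (sumBelow-swap g m n)) (sym (sumBelow-+ _ _ n))

  sumBelow-extend : ∀ (f : ℕ → Carrier) {m n} → m ≤′ n → (∀ {i} → m ≤ i → f i ≈ 0#) →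
                    sumBelow f n ≈ sumBelow f m
  sumBelow-extend f (≤′-reflexive ≡.refl) f≈0 = refl
  sumBelow-extend f (≤′-step m≤′n)      f≈0 =
    trans (+-cong (sumBelow-extend f m≤′n f≈0) (f≈0 (≤′⇒≤ m≤′n))) (+-identityʳ _)

module FieldProperties {c ℓ : Level} (K : Field c ℓ) where
  open Field K
  open import Relation.Binary.Reasoning.Setoid setoid

  *-nonzero : ∀ {a b} → ¬ (a ≈ 0#) → ¬ (b ≈ 0#) → ¬ (a * b ≈ 0#)
  *-nonzero {a} {b} a≉0 b≉0 ab≈0 = a≉0 (begin
    a                ≈⟨ *-identityʳ a ⟨
    a * 1#           ≈⟨ *-congˡ (⁻¹-inverse b b≉0) ⟨
    a * (b * b ⁻¹)   ≈⟨ *-assoc a b (b ⁻¹) ⟨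
    (a * b) * b ⁻¹   ≈⟨ *-congʳ ab≈0 ⟩
    0# * b ⁻¹        ≈⟨ zeroˡ _ ⟩
    0#               ∎)

module QIntegers {c ℓ : Level} (K : Field c ℓ) (q : Field.Carrier K) (tr : Transcendental K q) where
  open Field K
  open RingOps commutativeRing
  open FieldProperties K

  qint-suc : ∀ n → qint q (suc n) ≈ 1# + q * qint q n
  qint-suc zero    = trans (+-identityˡ 1#) (sym (trans (+-congˡ (zeroʳ q)) (+-identityʳ 1#)))
  qint-suc (suc n) = trans (+-congʳ (qint-suc n)) (trans (+-assoc _ _ _) (+-congˡ (sym (distribˡ q _ _))))

  evalℤ-replicate-1 : ∀ n → evalℤ K (replicate n (+ 1)) q ≈ qint q n
  evalℤ-replicate-1 zero    = refl
  evalℤ-replicate-1 (suc n) =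
    trans (+-cong (+-identityʳ 1#) (*-congˡ (evalℤ-replicate-1 n))) (sym (qint-suc n))

  qint-suc-nonzero : ∀ n → ¬ (qint q (suc n) ≈ 0#)
  qint-suc-nonzero n [n+1]≈0 with tr (replicate (suc n) (+ 1)) (trans (evalℤ-replicate-1 (suc n)) [n+1]≈0)
  ... | () ∷ _

  qfact-nonzero : ∀ n → ¬ (qfact q n ≈ 0#)
  qfact-nonzero zero    = 1≉0
  qfact-nonzero (suc n) = *-nonzero (qfact-nonzero n) (qint-suc-nonzero n)

module QSeries {c ℓ c' ℓ' : Level} (K : Field c ℓ) (q : Field.Carrier K) (tr : Transcendental K q)
               (A : CommutativeRing c' ℓ') (ι : Field.Carrier K → CommutativeRing.Carrier A)
               (hom : IsAlgebraMap K A ι) where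
  open QCalculus K q A ι
  open CommutativeRing A
  open RingOps A
  open SumProperties A
  open QIntegers K q tr
  open RingMorphisms.IsRingHomomorphism hom using (*-homo; 1#-homo) renaming (⟦⟧-cong to ι-cong)
  open CommutativeSemigroupProperties *-commutativeSemigroup using (x∙yz≈y∙xz; xy∙z≈x∙zy)
  open RingProperties ring using (-1*x≈-x; -‿distribˡ-*; -‿involutive)
  open import Relation.Binary.Reasoning.Setoid setoid

  ι-inverse : ∀ {x} → ¬ (x K.≈ K.0#) → ι x * ι (x K.⁻¹) ≈ 1#
  ι-inverse {x} x≉0 = begin
    ι x * ι (x K.⁻¹)  ≈⟨ *-homo x (x K.⁻¹) ⟨
    ι (x K.* x K.⁻¹)  ≈⟨ ι-cong (K.⁻¹-inverse x x≉0) ⟩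
    ι K.1#            ≈⟨ 1#-homo ⟩
    1#                ∎

  inv[suc]q-cancel : ∀ n x → inv[ suc n ]q * ([ suc n ]q * x) ≈ x
  inv[suc]q-cancel n x = begin
    inv[ suc n ]q * ([ suc n ]q * x)  ≈⟨ *-assoc _ _ _ ⟨
    (inv[ suc n ]q * [ suc n ]q) * x  ≈⟨ *-congʳ (trans (*-comm _ _) (ι-inverse (qint-suc-nonzero n))) ⟩
    1# * x                            ≈⟨ *-identityˡ x ⟩
    x                                 ∎

  inv[0]q! : inv[ 0 ]q! ≈ 1#
  inv[0]q! = begin
    inv[ 0 ]q!           ≈⟨ *-identityˡ _ ⟨
    1# * inv[ 0 ]q!      ≈⟨ *-congʳ 1#-homo ⟨
    ι K.1# * inv[ 0 ]q!  ≈⟨ ι-inverse K.1≉0 ⟩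
    1#                   ∎

  inv[suc]q!-*-[suc]q : ∀ n → inv[ suc n ]q! * [ suc n ]q ≈ inv[ n ]q!
  inv[suc]q!-*-[suc]q n = begin
    w * b              ≈⟨ *-identityʳ _ ⟨
    (w * b) * 1#       ≈⟨ *-congˡ (ι-inverse (qfact-nonzero n)) ⟨
    (w * b) * (a * u)  ≈⟨ *-assoc _ _ _ ⟨
    ((w * b) * a) * u  ≈⟨ *-congʳ (xy∙z≈x∙zy w b a) ⟩
    (w * (a * b)) * u  ≈⟨ *-congʳ (*-congˡ (*-homo _ _)) ⟨
    (w * f) * u        ≈⟨ *-congʳ (trans (*-comm w f) (ι-inverse (qfact-nonzero (suc n)))) ⟩
    1# * u             ≈⟨ *-identityˡ u ⟩
    u                  ∎
    where
    w = inv[ suc n ]q!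
    b = [ suc n ]q
    a = ι (KO.qfact q n)
    f = ι (KO.qfact q (suc n))
    u = inv[ n ]q!

  *ₛ-congˡ-≤ : ∀ {F G} H n → (∀ {i} → i ≤ n → F i ≈ G i) → (F *ₛ H) n ≈ (G *ₛ H) n
  *ₛ-congˡ-≤ H n F≈G = sumBelow-cong (suc n) (λ i<1+n → *-congʳ (F≈G (s≤s⁻¹ i<1+n)))

  *ₛ-congʳ : ∀ F {G H} → G ≈ₛ H → (F *ₛ G) ≈ₛ (F *ₛ H)
  *ₛ-congʳ F G≈H n = sumBelow-cong (suc n) (λ {i} _ → *-congˡ (G≈H (n ∸ i)))

  *ₛ-zeroˡ-≤ : ∀ {F} G n → (∀ {i} → i ≤ n → F i ≈ 0#) → (F *ₛ G) n ≈ 0#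
  *ₛ-zeroˡ-≤ G n F≈0 = sumBelow-zero (suc n) (λ i<1+n → trans (*-congʳ (F≈0 (s≤s⁻¹ i<1+n))) (zeroˡ _))

  Dq-unique : ∀ {Y Z H} → Y 0 ≈ Z 0 → Dq Y ≈ₛ (Y *ₛ H) → Dq Z ≈ₛ (Z *ₛ H) → Y ≈ₛ Z
  Dq-unique {Y} {Z} {H} Y₀≈Z₀ DqY DqZ = <-rec (λ n → Y n ≈ Z n) step
    where
    step : ∀ n → (∀ {m} → m < n → Y m ≈ Z m) → Y n ≈ Z n
    step zero    _    = Y₀≈Z₀
    step (suc n) Y≈Z = begin
      Y (suc n)                   ≈⟨ inv[suc]q-cancel n _ ⟨
      inv[ suc n ]q * Dq Y n      ≈⟨ *-congˡ (DqY n) ⟩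
      inv[ suc n ]q * (Y *ₛ H) n  ≈⟨ *-congˡ (*ₛ-congˡ-≤ H n (λ i≤n → Y≈Z (s≤s i≤n))) ⟩
      inv[ suc n ]q * (Z *ₛ H) n  ≈⟨ *-congˡ (DqZ n) ⟨
      inv[ suc n ]q * Dq Z n      ≈⟨ inv[suc]q-cancel n _ ⟩
      Z (suc n)                   ∎

  Dq-negNeg-Pq : ∀ p → Dq (negNeg (Pq p)) ≈ₛ (λ m → sign m * p (suc m))
  Dq-negNeg-Pq p m = begin
    x * - ((- 1# * s) * (P * y))  ≈⟨ *-congˡ (-‿cong (*-congʳ (-1*x≈-x s))) ⟩
    x * - (- s * (P * y))         ≈⟨ *-congˡ (-‿cong (-‿distribˡ-* s _)) ⟨
    x * - (- (s * (P * y)))       ≈⟨ *-congˡ (-‿involutive _) ⟩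
    x * (s * (P * y))             ≈⟨ x∙yz≈y∙xz x s _ ⟩
    s * (x * (P * y))             ≈⟨ *-congˡ (x∙yz≈y∙xz x P y) ⟩
    s * (P * (x * y))             ≈⟨ *-congˡ (*-congˡ (ι-inverse (qint-suc-nonzero m))) ⟩
    s * (P * 1#)                  ≈⟨ *-congˡ (*-identityʳ P) ⟩
    s * P                         ∎
    where
    x = [ suc m ]q
    s = sign m
    P = p (suc m)
    y = inv[ suc m ]q

  module _ {F : Series} {Fk : ℕ → Series} (isQPowers : IsQPowers F Fk) where
    private
      Fk₀≈1 : Fk 0 ≈ₛ oneₛ
      Fk₀≈1 = proj₁ isQPowers

      Fk[suc]₀≈0 : ∀ k → Fk (suc k) 0 ≈ 0#
      Fk[suc]₀≈0 = proj₁ (proj₂ isQPowers)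

      Dq-Fk[suc] : ∀ k → Dq (Fk (suc k)) ≈ₛ (λ n → [ suc k ]q * (Fk k *ₛ Dq F) n)
      Dq-Fk[suc] = proj₂ (proj₂ isQPowers)

    qPowers-vanish : ∀ {k n} → n < k → Fk k n ≈ 0#
    qPowers-vanish {suc k} {zero}  _         = Fk[suc]₀≈0 k
    qPowers-vanish {suc k} {suc n} (s≤s n<k) = begin
      Fk (suc k) (suc n)                                ≈⟨ inv[suc]q-cancel n _ ⟨
      inv[ suc n ]q * Dq (Fk (suc k)) n                 ≈⟨ *-congˡ (Dq-Fk[suc] k n) ⟩
      inv[ suc n ]q * ([ suc k ]q * (Fk k *ₛ Dq F) n)   ≈⟨ *-congˡ (*-congˡ (*ₛ-zeroˡ-≤ (Dq F) n Fk[k]≈0)) ⟩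
      inv[ suc n ]q * ([ suc k ]q * 0#)                 ≈⟨ *-congˡ (zeroʳ _) ⟩
      inv[ suc n ]q * 0#                                ≈⟨ zeroʳ _ ⟩
      0#                                                ∎
      where
      Fk[k]≈0 : ∀ {j} → j ≤ n → Fk k j ≈ 0#
      Fk[k]≈0 j≤n = qPowers-vanish (≤-<-trans j≤n n<k)

    eqCompose-zero : eqCompose Fk 0 ≈ 1#
    eqCompose-zero = begin
      0# + inv[ 0 ]q! * Fk 0 0  ≈⟨ +-identityˡ _ ⟩
      inv[ 0 ]q! * Fk 0 0       ≈⟨ *-cong inv[0]q! (Fk₀≈1 0) ⟩
      1# * 1#                   ≈⟨ *-identityˡ 1# ⟩
      1#                        ∎

    eqCompose-extend : ∀ {i n} → i ≤ n → eqCompose Fk i ≈ sumUpTo (λ k → inv[ k ]q! * Fk k i) n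
    eqCompose-extend i≤n = sym (sumBelow-extend _ (≤⇒≤′ (s≤s i≤n))
                                  (λ i<k → trans (*-congˡ (qPowers-vanish i<k)) (zeroʳ _)))

    eqCompose-*ₛ : ∀ S n → (eqCompose Fk *ₛ S) n ≈ sumUpTo (λ k → inv[ k ]q! * (Fk k *ₛ S) n) n
    eqCompose-*ₛ S n = begin
      sumUpTo (λ i → eqCompose Fk i * S (n ∸ i)) n
        ≈⟨ sumBelow-cong (suc n) (λ i<1+n → *-congʳ (eqCompose-extend (s≤s⁻¹ i<1+n))) ⟩
      sumUpTo (λ i → sumUpTo (λ k → inv[ k ]q! * Fk k i) n * S (n ∸ i)) n
        ≈⟨ sumBelow-cong (suc n) (λ {i} _ → *-distribʳ-sumBelow (S (n ∸ i)) _ (suc n)) ⟩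
      sumUpTo (λ i → sumUpTo (λ k → inv[ k ]q! * Fk k i * S (n ∸ i)) n) n
        ≈⟨ sumBelow-swap _ (suc n) (suc n) ⟩
      sumUpTo (λ k → sumUpTo (λ i → inv[ k ]q! * Fk k i * S (n ∸ i)) n) n
        ≈⟨ sumBelow-cong (suc n) (λ {k} _ → trans (sumBelow-cong (suc n) (λ _ → *-assoc _ _ _))
                                                  (sym (*-distribˡ-sumBelow inv[ k ]q! _ (suc n)))) ⟩
      sumUpTo (λ k → inv[ k ]q! * (Fk k *ₛ S) n) n
        ∎

    Dq-eqCompose : Dq (eqCompose Fk) ≈ₛ (eqCompose Fk *ₛ Dq F)
    Dq-eqCompose n = begin
      [ suc n ]q * sumUpTo g (suc n)                        ≈⟨ *-congˡ (sumBelow-suc g (suc n)) ⟩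
      [ suc n ]q * (g 0 + sumUpTo (λ j → g (suc j)) n)      ≈⟨ *-congˡ (+-congʳ g₀≈0) ⟩
      [ suc n ]q * (0# + sumUpTo (λ j → g (suc j)) n)       ≈⟨ *-congˡ (+-identityˡ _) ⟩
      [ suc n ]q * sumUpTo (λ j → g (suc j)) n              ≈⟨ *-distribˡ-sumBelow _ _ (suc n) ⟩
      sumUpTo (λ j → [ suc n ]q * g (suc j)) n              ≈⟨ sumBelow-cong (suc n) (λ {j} _ → term j) ⟩
      sumUpTo (λ j → inv[ j ]q! * (Fk j *ₛ Dq F) n) n       ≈⟨ eqCompose-*ₛ (Dq F) n ⟨
      (eqCompose Fk *ₛ Dq F) n                              ∎
      where
      g : ℕ → Carrier
      g k = inv[ k ]q! * Fk k (suc n)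

      g₀≈0 : g 0 ≈ 0#
      g₀≈0 = trans (*-congˡ (Fk₀≈1 (suc n))) (zeroʳ _)

      term : ∀ j → [ suc n ]q * g (suc j) ≈ inv[ j ]q! * (Fk j *ₛ Dq F) n
      term j = begin
        [ suc n ]q * (inv[ suc j ]q! * Fk (suc j) (suc n))  ≈⟨ x∙yz≈y∙xz _ _ _ ⟩
        inv[ suc j ]q! * Dq (Fk (suc j)) n                  ≈⟨ *-congˡ (Dq-Fk[suc] j n) ⟩
        inv[ suc j ]q! * ([ suc j ]q * (Fk j *ₛ Dq F) n)    ≈⟨ *-assoc _ _ _ ⟨
        (inv[ suc j ]q! * [ suc j ]q) * (Fk j *ₛ Dq F) n    ≈⟨ *-congʳ (inv[suc]q!-*-[suc]q j) ⟩
        inv[ j ]q! * (Fk j *ₛ Dq F) n                       ∎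

theorem5p5 : {c ℓ c' ℓ' : Level} (K : Field c ℓ) (q : Field.Carrier K) →
    Transcendental K q →
    (A : CommutativeRing c' ℓ') (ι : Field.Carrier K → CommutativeRing.Carrier A) →
    IsAlgebraMap K A ι →
    (e : ℕ → CommutativeRing.Carrier A) →
    CommutativeRing._≈_ A (e 0) (CommutativeRing.1# A) →
    (p : ℕ → CommutativeRing.Carrier A) →
    QCalculus.IsQPowerSums K q A ι e p →
    (Fk : ℕ → QCalculus.Series K q A ι) →
    QCalculus.IsQPowers K q A ι (QCalculus.negNeg K q A ι (QCalculus.Pq K q A ι p)) Fk →
    QCalculus._≈ₛ_ K q A ι e (QCalculus.eqCompose K q A ι Fk)
theorem5p5 K q tr A ι hom e e₀≈1 p isQPowerSums Fk isQPowers =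
  Dq-unique {H = H} e₀≈G₀ isQPowerSums Dq-G
  where
  open CommutativeRing A using (_≈_; _*_; trans; sym)
  open RingOps A using (sign)
  open QCalculus K q A ι
  open QSeries K q tr A ι hom

  F H G : Series
  F = negNeg (Pq p)
  H m = sign m * p (suc m)
  G = eqCompose Fk

  e₀≈G₀ : e 0 ≈ G 0
  e₀≈G₀ = trans e₀≈1 (sym (eqCompose-zero {F} isQPowers))

  Dq-G : Dq G ≈ₛ (G *ₛ H)
  Dq-G n = trans (Dq-eqCompose {F} isQPowers n) (*ₛ-congʳ G (Dq-negNeg-Pq p) n)
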